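{- For every $k\in\mathbb{N}$ there exists a $(k,q)$-round-adaptive testing algorithm for $(2k+1)$-cycle freeness, and one for $(2k+2)$-cycle freeness, in the bounded-degree graph model with degree bound $d$, with query complexity $q=O(d^{k+1}/\varepsilon)$.
   Context: Bounded-degree graph model: a graph $G=(V,E)$ with $|V|=n$ and maximum degree at most $d<n$ is represented by $g\colon V\times[d]\to V\cup\{0\}$, $g(v,i)$ being the $i$-th neighbor of $v$ or $0$ if none. The distance from a property is the minimal fraction of the $dn$ entries of $g$ to change to get a member. A $(k,q)$-round-adaptive tester: given proximity parameter $\varepsilon\in(0,1]$ and query access to $g$, proceeds in $k+1$ rounds, in round $\ell\ge0$ choosing queries $(v,i)$ based on its randomness and earlier answers and receiving $g(v,i)$; at most $q$ queries in total; accepts w.p. $\ge2/3$ graphs with the property and rejects w.p. $\ge 2/3$ graphs at distance more than $\varepsilon$. A graph is $t$-cycle free if it has no cycle of length at most $t$.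
   Formalization: The proximity parameter ε takes only rational values in (0,1]. -}

module Defs where

open import Data.Nat using (ℕ; zero; suc; _+_; _*_; _^_; _≤_; _<_)
open import Data.Fin using (Fin; inject₁; fromℕ) renaming (zero to fzero; suc to fsuc; _≟_ to _≟F_; _≤_ to _≤F_)
open import Data.Maybe using (Maybe; just; nothing)
open import Data.Maybe.Properties using (≡-dec)
open import Data.Bool using (Bool; true; false; T; not)
open import Data.Vec using (Vec; []; _∷_)
open import Data.List using (List; []; _∷_; _++_; map; length; filter; allFin; concatMap; cartesianProduct)
open import Data.Product using (Σ; ∃; _×_; _,_)
open import Relation.Nullary using (¬_; ¬?; Dec)
open import Relation.Binary.PropositionalEquality using (_≡_; _≢_)
open import Function.Definitions using (Injective)

-- Bounded-degree graph representation g : V × [d] → V ∪ {0},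
-- with V = Fin n, [d] = Fin d, and 0 represented by 'nothing'.
Rep : ℕ → ℕ → Set
Rep n d = Fin n → Fin d → Maybe (Fin n)

record Valid {n d : ℕ} (g : Rep n d) : Set where
  field
    prefix    : ∀ v i j → i ≤F j → g v i ≡ nothing → g v j ≡ nothing
    noLoop    : ∀ v i → g v i ≢ just v
    noRepeat  : ∀ v i j u → g v i ≡ just u → g v j ≡ just u → i ≡ j
    symmetric : ∀ v u i → g v i ≡ just u → ∃ λ j → g u j ≡ just v

Adj : {n d : ℕ} → Rep n d → Fin n → Fin n → Set
Adj g u v = ∃ λ i → g u i ≡ just v

-- A cycle of length 3 + m: distinct vertices f 0, …, f (m+2), consecutive
-- ones adjacent, and the last adjacent to the first.
Cycle : {n d : ℕ} → Rep n d → ℕ → Set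
Cycle {n} g m =
  Σ (Fin (suc (suc (suc m))) → Fin n) λ f →
    Injective _≡_ _≡_ f
    × (∀ (i : Fin (suc (suc m))) → Adj g (f (inject₁ i)) (f (fsuc i)))
    × Adj g (f (fromℕ (suc (suc m)))) (f fzero)

CycleFree : {n d : ℕ} → ℕ → Rep n d → Set
CycleFree t g = ∀ m → 3 + m ≤ t → ¬ Cycle g m

diffCount : {n d : ℕ} → Rep n d → Rep n d → ℕ
diffCount {n} {d} g g' =
  length (filter (λ p → ¬? (≡-dec _≟F_ (g (Data.Product.proj₁ p) (Data.Product.proj₂ p))
                                      (g' (Data.Product.proj₁ p) (Data.Product.proj₂ p))))
                 (cartesianProduct (allFin n) (allFin d)))

-- distance from t-cycle freeness is more than ε = a / b:
-- every valid t-cycle-free representation differs from g in more than ε·d·n entries.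
FarFromCycleFree : {n d : ℕ} → ℕ → ℕ → ℕ → Rep n d → Set
FarFromCycleFree {n} {d} t a b g =
  ∀ (g' : Rep n d) → Valid g' → CycleFree t g' → a * (d * n) < b * diffCount g g'

Query : ℕ → ℕ → Set
Query n d = Fin n × Fin d

History : ℕ → ℕ → Set
History n d = List (Query n d × Maybe (Fin n))

-- A randomized round-adaptive query algorithm using r uniformly random bits.
record Tester (n d : ℕ) : Set where
  field
    rbits  : ℕ
    round  : ℕ → Vec Bool rbits → History n d → List (Query n d)
    decide : Vec Bool rbits → History n d → Bool

-- history after the first ℓ rounds (rounds 0, …, ℓ-1)
runRounds : {n d : ℕ} (A : Tester n d) → Rep n d → Vec Bool (Tester.rbits A) → ℕ → History n d
runRounds A g ρ zero = []
runRounds A g ρ (suc ℓ) =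
  let h = runRounds A g ρ ℓ in
  h ++ map (λ q → q , g (Data.Product.proj₁ q) (Data.Product.proj₂ q)) (Tester.round A ℓ ρ h)

allVecs : (r : ℕ) → List (Vec Bool r)
allVecs zero = [] ∷ []
allVecs (suc r) = concatMap (λ v → (true ∷ v) ∷ (false ∷ v) ∷ []) (allVecs r)

outCount : {n d : ℕ} (A : Tester n d) → ℕ → Rep n d → Bool → ℕ
outCount A k g out =
  length (filter (λ ρ → Data.Bool._≟_ (Tester.decide A ρ (runRounds A g ρ (suc k))) out)
                 (allVecs (Tester.rbits A)))

record IsRoundAdaptiveTester {n d : ℕ} (t k q a b : ℕ) (A : Tester n d) : Set where
  field
    queryBound : ∀ g ρ → length (runRounds A g ρ (suc k)) ≤ q
    accepts    : ∀ g → Valid g → CycleFree t g →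
                 2 * 2 ^ Tester.rbits A ≤ 3 * outCount A k g true
    rejects    : ∀ g → Valid g → FarFromCycleFree t a b g →
                 2 * 2 ^ Tester.rbits A ≤ 3 * outCount A k g false

-- The tester samples s = 2u start vertices, u ≥ 8/ε, and explores each to depth k + 1: in
-- round ℓ it queries every slot of every vertex reached by a port sequence of length ℓ, which
-- costs (k + 1)·s·d^(k+1) queries, and it accepts iff the edges it has seen contain no cycle of
-- length ≤ t. Seen edges are real edges, so t-cycle-free graphs are always accepted. Every edge
-- of a cycle of length ≤ 2k + 2 through a sampled vertex is within distance k of it along the
-- cycle in one direction or the other, so such a cycle is seen completely.
-- If g is ε-far, many vertices are bad (lie on a cycle of length ≤ t): deleting an edge of a
-- short cycle at a bad vertex changes at most 4 entries and lowers the total degree of bad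
-- vertices, so some t-cycle-free graph is within 4·d·#bad entries of g, whence #bad > εn/4.
-- A sample (n random bits reduced mod n) is then bad with probability ≥ #bad/(2n) ≥ 1/u, and
-- all 2u samples miss the bad vertices with probability ≤ (1 - 1/u)^(2u) ≤ 1/4.

module Submission where

open import Data.Nat.Properties hiding (_≟_; _<?_)
open import Algebra.Properties.Semiring.Sum +-*-semiring using (sum; sum-syntax; sum-cong-≗; ∑-distrib-+; *-distribˡ-sum)
open import Data.Bool as Bool using (Bool; true; false; not; if_then_else_)
open import Data.Fin as Fin using (Fin; zero; suc; toℕ; inject₁; fromℕ; _≟_; _<?_)
open import Data.Fin.Induction using (<-weakInduction; >-weakInduction; >-wellFounded)
open import Data.Fin.Properties using (any?; all?; toℕ-injective; toℕ-fromℕ<; toℕ-inject₁; toℕ-fromℕ; toℕ<n)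
import Data.Fin.Properties as Finₚ
open import Data.List using (List; []; _∷_; _++_; map; length; filter; concatMap; allFin; tabulate; cartesianProduct)
open import Data.List.Properties using (length-map; length-++; length-tabulate)
open import Data.List.Membership.Propositional using (_∈_)
open import Data.List.Membership.Propositional.Properties using (∈-map⁺; ∈-map⁻; ∈-++⁺ˡ; ∈-++⁺ʳ; ∈-++⁻; ∈-concat⁺′; ∈-allFin)
open import Data.List.Relation.Unary.Any using (here; there)
open import Data.Maybe using (Maybe; just; nothing; fromMaybe; _>>=_)
open import Data.Maybe.Properties using (just-injective)
import Data.Maybe.Properties as Maybe
open import Data.Nat using (ℕ; zero; suc; _+_; _*_; _^_; _∸_; _≤_; _<_; z≤n; s≤s; _≤?_; NonZero; >-nonZero)
open import Data.Nat.DivMod using (_mod_; _%_; _/_; m≡m%n+[m/n]*n; m%n<n; m/n*n≤m; m≥n⇒m/n>0; [m+n]%n≡m%n; m<n⇒m%n≡m)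
open import Data.Nat.Induction using (<-wellFounded)
open import Data.Nat.Tactic.RingSolver using (solve-∀)
open import Data.Product using (Σ; ∃; _×_; _,_; proj₁; proj₂)
import Data.Product.Properties as Product
open import Data.Sum using (_⊎_; inj₁; inj₂)
open import Data.Vec as Vec using (Vec; []; _∷_; take; drop)
import Data.Vec.Properties as Vecₚ
open import Function using (_∘_)
open import Function.Definitions using (Injective)
open import Induction.WellFounded using (Acc; acc)
open import Relation.Binary.PropositionalEquality
open import Relation.Nullary using (Dec; yes; no; does; ¬_; ¬?; contradiction)
open import Relation.Nullary.Decidable using (map′; _×-dec_; _→-dec_; _⊎-dec_; dec-true; dec-false)

open import Defs

private variable
  A B : Set

indicator : ∀ {p} {P : Set p} → Dec P → ℕ
indicator P? = if does P? then 1 else 0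

indicator-mono : ∀ {p q} {P : Set p} {Q : Set q} → (P → Q) → (P? : Dec P) (Q? : Dec Q) → indicator P? ≤ indicator Q?
indicator-mono P⇒Q (yes p) (no ¬q) = contradiction (P⇒Q p) ¬q
indicator-mono P⇒Q (yes _) (yes _) = ≤-refl
indicator-mono P⇒Q (no _)  _       = z≤n

indicator-yes : ∀ {p} {P : Set p} (P? : Dec P) → P → indicator P? ≡ 1
indicator-yes P? p = cong (if_then 1 else 0) (dec-true P? p)

∑-mono : ∀ {n} {f g : Fin n → ℕ} → (∀ i → f i ≤ g i) → sum f ≤ sum g
∑-mono {zero}  f≤g = z≤n
∑-mono {suc n} f≤g = +-mono-≤ (f≤g zero) (∑-mono (f≤g ∘ suc))

∑-const : ∀ n c → ∑[ i < n ] c ≡ n * c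
∑-const zero    c = refl
∑-const (suc n) c = cong (c +_) (∑-const n c)

∑-indicator-≟ : ∀ {n} (u : Fin n) → ∑[ x < n ] indicator (x ≟ u) ≡ 1
∑-indicator-≟ {suc n} zero = cong suc (trans (sum-cong-≗ {n} (λ _ → refl)) (trans (∑-const n 0) (*-zeroʳ n)))
∑-indicator-≟ {suc n} (suc u) = ∑-indicator-≟ u


listSum : List A → (A → ℕ) → ℕ
listSum []       F = 0
listSum (x ∷ xs) F = F x + listSum xs F

length-filter≡listSum : {P : A → Set} (P? : ∀ x → Dec (P x)) (xs : List A) →
  length (filter P? xs) ≡ listSum xs (indicator ∘ P?)
length-filter≡listSum P? [] = refl
length-filter≡listSum P? (x ∷ xs) with P? x
... | yes _ = cong suc (length-filter≡listSum P? xs)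
... | no _  = length-filter≡listSum P? xs


listSum-cong : ∀ (xs : List A) {F G : A → ℕ} → (∀ x → F x ≡ G x) → listSum xs F ≡ listSum xs G
listSum-cong []       F≗G = refl
listSum-cong (x ∷ xs) F≗G = cong₂ _+_ (F≗G x) (listSum-cong xs F≗G)

listSum-mono : ∀ (xs : List A) {F G : A → ℕ} → (∀ x → F x ≤ G x) → listSum xs F ≤ listSum xs G
listSum-mono []       F≤G = z≤n
listSum-mono (x ∷ xs) F≤G = +-mono-≤ (F≤G x) (listSum-mono xs F≤G)

listSum-++ : ∀ (xs ys : List A) F → listSum (xs ++ ys) F ≡ listSum xs F + listSum ys F
listSum-++ []       ys F = refl
listSum-++ (x ∷ xs) ys F = trans (cong (F x +_) (listSum-++ xs ys F)) (sym (+-assoc (F x) _ _))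

listSum-+ : ∀ (xs : List A) F G → listSum xs (λ x → F x + G x) ≡ listSum xs F + listSum xs G
listSum-+ []       F G = refl
listSum-+ (x ∷ xs) F G = trans (cong (F x + G x +_) (listSum-+ xs F G)) (+-+-comm (F x) (G x) _ _)
  where
  +-+-comm : ∀ a b c d → a + b + (c + d) ≡ a + c + (b + d)
  +-+-comm = solve-∀

listSum-*ˡ : ∀ (xs : List A) c F → listSum xs (λ x → c * F x) ≡ c * listSum xs F
listSum-*ˡ []       c F = sym (*-zeroʳ c)
listSum-*ˡ (x ∷ xs) c F = trans (cong (c * F x +_) (listSum-*ˡ xs c F)) (sym (*-distribˡ-+ c (F x) _))

listSum-concatMap : ∀ (f : A → List B) (xs : List A) (F : B → ℕ) →
  listSum (concatMap f xs) F ≡ listSum xs (λ x → listSum (f x) F)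
listSum-concatMap f []       F = refl
listSum-concatMap f (x ∷ xs) F =
  trans (listSum-++ (f x) (concatMap f xs) F) (cong (listSum (f x) F +_) (listSum-concatMap f xs F))

listSum-map : ∀ (f : A → B) xs (F : B → ℕ) → listSum (map f xs) F ≡ listSum xs (F ∘ f)
listSum-map f []       F = refl
listSum-map f (x ∷ xs) F = cong (F (f x) +_) (listSum-map f xs F)

listSum-cartesianProduct : ∀ (xs : List A) (ys : List B) F →
  listSum (cartesianProduct xs ys) F ≡ listSum xs (λ x → listSum ys (λ y → F (x , y)))
listSum-cartesianProduct []       ys F = refl
listSum-cartesianProduct (x ∷ xs) ys F =
  trans (listSum-++ (map (x ,_) ys) _ F) (cong₂ _+_ (listSum-map (x ,_) ys F) (listSum-cartesianProduct xs ys F))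

listSum-tabulate : ∀ {k} (f : Fin k → A) F → listSum (tabulate f) F ≡ ∑[ i < k ] F (f i)
listSum-tabulate {k = zero}  f F = refl
listSum-tabulate {k = suc k} f F = cong (F (f zero) +_) (listSum-tabulate (f ∘ suc) F)

listSum-allFin : ∀ {k} F → listSum (allFin k) F ≡ ∑[ i < k ] F i
listSum-allFin = listSum-tabulate (λ i → i)

∈-concatMap : ∀ {f : A → List B} {x xs y} → y ∈ f x → x ∈ xs → y ∈ concatMap f xs
∈-concatMap {f = f} y∈fx x∈xs = ∈-concat⁺′ y∈fx (∈-map⁺ f x∈xs)

length-concatMap : ∀ (f : A → List B) xs → length (concatMap f xs) ≡ listSum xs (length ∘ f)
length-concatMap f []       = refl
length-concatMap f (x ∷ xs) = trans (length-++ (f x)) (cong (length (f x) +_) (length-concatMap f xs))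

listSum-const : ∀ (xs : List A) c → listSum xs (λ _ → c) ≡ length xs * c
listSum-const []       c = refl
listSum-const (x ∷ xs) c = cong (c +_) (listSum-const xs c)

rangeSum : ℕ → (ℕ → ℕ) → ℕ
rangeSum zero    F = 0
rangeSum (suc N) F = F 0 + rangeSum N (F ∘ suc)

rangeSum-cong : ∀ N {F G : ℕ → ℕ} → (∀ y → F y ≡ G y) → rangeSum N F ≡ rangeSum N G
rangeSum-cong zero    F≗G = refl
rangeSum-cong (suc N) F≗G = cong₂ _+_ (F≗G 0) (rangeSum-cong N (F≗G ∘ suc))

rangeSum-+ : ∀ N M F → rangeSum (N + M) F ≡ rangeSum N F + rangeSum M (λ y → F (N + y))
rangeSum-+ zero    M F = refl
rangeSum-+ (suc N) M F = trans (cong (F 0 +_) (rangeSum-+ N M (F ∘ suc))) (sym (+-assoc (F 0) _ _))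

rangeSum-mono-length : ∀ {N M} F → N ≤ M → rangeSum N F ≤ rangeSum M F
rangeSum-mono-length {N} {M} F N≤M = begin
  rangeSum N F                                 ≤⟨ m≤m+n _ _ ⟩
  rangeSum N F + rangeSum (M ∸ N) (F ∘ (N +_)) ≡⟨ rangeSum-+ N (M ∸ N) F ⟨
  rangeSum (N + (M ∸ N)) F                     ≡⟨ cong (λ L → rangeSum L F) (m+[n∸m]≡n N≤M) ⟩
  rangeSum M F                                 ∎
  where open ≤-Reasoning

rangeSum-const : ∀ N c → rangeSum N (λ _ → c) ≡ N * c
rangeSum-const zero    c = refl
rangeSum-const (suc N) c = cong (c +_) (rangeSum-const N c)

rangeSum-periodic : ∀ {p} F → (∀ y → F (p + y) ≡ F y) → ∀ Q → rangeSum (Q * p) F ≡ Q * rangeSum p F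
rangeSum-periodic F per zero    = refl
rangeSum-periodic {p} F per (suc Q) =
  trans (rangeSum-+ p (Q * p) F)
        (cong (rangeSum p F +_) (trans (rangeSum-cong (Q * p) per) (rangeSum-periodic F per Q)))

rangeSum≡∑ : ∀ N F → rangeSum N F ≡ ∑[ i < N ] F (toℕ i)
rangeSum≡∑ zero    F = refl
rangeSum≡∑ (suc N) F = cong (F 0 +_) (rangeSum≡∑ N (F ∘ suc))

rangeSum-double : ∀ N F → rangeSum (N + N) F ≡ rangeSum N (λ y → F (y + y) + F (suc (y + y)))
rangeSum-double zero    F = refl
rangeSum-double (suc N) F rewrite +-suc N N =
  trans (sym (+-assoc (F 0) (F 1) _))
        (cong (F 0 + F 1 +_) (trans (rangeSum-double N (λ y → F (2 + y))) (rangeSum-cong N shift)))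
  where
  shift : ∀ y → F (suc (suc (y + y))) + F (suc (suc (suc (y + y))))
              ≡ F (suc y + suc y) + F (suc (suc y + suc y))
  shift y rewrite +-suc y y = refl

-- Counting over uniformly random bit strings

bitsValue : ∀ {m} → Vec Bool m → ℕ
bitsValue []          = 0
bitsValue (false ∷ v) = bitsValue v + bitsValue v
bitsValue (true ∷ v)  = suc (bitsValue v + bitsValue v)

listSum-allVecs-bitsValue : ∀ m F → listSum (allVecs m) (F ∘ bitsValue) ≡ rangeSum (2 ^ m) F
listSum-allVecs-bitsValue zero    F = refl
listSum-allVecs-bitsValue (suc m) F = begin
  listSum (allVecs (suc m)) (F ∘ bitsValue)
    ≡⟨ listSum-concatMap (λ v → (true ∷ v) ∷ (false ∷ v) ∷ []) (allVecs m) (F ∘ bitsValue) ⟩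
  listSum (allVecs m) (λ v → F (suc (bitsValue v + bitsValue v)) + (F (bitsValue v + bitsValue v) + 0))
    ≡⟨ listSum-cong (allVecs m) (λ v → swap (F (suc (bitsValue v + bitsValue v))) (F (bitsValue v + bitsValue v))) ⟩
  listSum (allVecs m) (G ∘ bitsValue)
    ≡⟨ listSum-allVecs-bitsValue m G ⟩
  rangeSum (2 ^ m) G
    ≡⟨ rangeSum-double (2 ^ m) F ⟨
  rangeSum (2 ^ m + 2 ^ m) F
    ≡⟨ cong (λ N → rangeSum (2 ^ m + N) F) (+-identityʳ (2 ^ m)) ⟨
  rangeSum (2 ^ suc m) F ∎
  where
  open ≡-Reasoning
  G : ℕ → ℕ
  G y = F (y + y) + F (suc (y + y))
  swap : ∀ a b → a + (b + 0) ≡ b + a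
  swap = solve-∀

listSum-allVecs-const : ∀ r c → listSum (allVecs r) (λ _ → c) ≡ 2 ^ r * c
listSum-allVecs-const r c = trans (listSum-allVecs-bitsValue r (λ _ → c)) (rangeSum-const (2 ^ r) c)

take-++ : ∀ {m r} (x : Vec A m) (y : Vec A r) → take m (x Vec.++ y) ≡ x
take-++ {m = m} x y = Vecₚ.++-injectiveˡ (take m (x Vec.++ y)) x (Vecₚ.take++drop≡id m (x Vec.++ y))

drop-++ : ∀ {m r} (x : Vec A m) (y : Vec A r) → drop m (x Vec.++ y) ≡ y
drop-++ {m = m} x y = Vecₚ.++-injectiveʳ (take m (x Vec.++ y)) x (Vecₚ.take++drop≡id m (x Vec.++ y))

listSum-allVecs-++ : ∀ m r (F : Vec Bool (m + r) → ℕ) →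
  listSum (allVecs (m + r)) F ≡ listSum (allVecs m) (λ x → listSum (allVecs r) (λ y → F (x Vec.++ y)))
listSum-allVecs-++ zero    r F = sym (+-identityʳ _)
listSum-allVecs-++ (suc m) r F = begin
  listSum (allVecs (suc m + r)) F
    ≡⟨ listSum-concatMap branch (allVecs (m + r)) F ⟩
  listSum (allVecs (m + r)) (λ v → F (true ∷ v) + (F (false ∷ v) + 0))
    ≡⟨ listSum-allVecs-++ m r _ ⟩
  listSum (allVecs m) (λ x → listSum (allVecs r) (λ y → F (true ∷ x Vec.++ y) + (F (false ∷ x Vec.++ y) + 0)))
    ≡⟨ listSum-cong (allVecs m) (λ x → split (λ y → F (true ∷ x Vec.++ y)) (λ y → F (false ∷ x Vec.++ y))) ⟩
  listSum (allVecs m) (λ x → listSum (allVecs r) (λ y → F (true ∷ x Vec.++ y))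
                             + (listSum (allVecs r) (λ y → F (false ∷ x Vec.++ y)) + 0))
    ≡⟨ listSum-concatMap branch (allVecs m) (λ x → listSum (allVecs r) (λ y → F (x Vec.++ y))) ⟨
  listSum (allVecs (suc m)) (λ x → listSum (allVecs r) (λ y → F (x Vec.++ y))) ∎
  where
  open ≡-Reasoning
  branch : ∀ {k} → Vec Bool k → List (Vec Bool (suc k))
  branch v = (true ∷ v) ∷ (false ∷ v) ∷ []
  split : ∀ (G H : Vec Bool r → ℕ) →
    listSum (allVecs r) (λ y → G y + (H y + 0)) ≡ listSum (allVecs r) G + (listSum (allVecs r) H + 0)
  split G H = trans (listSum-cong (allVecs r) (λ y → cong (G y +_) (+-identityʳ (H y))))
                    (trans (listSum-+ (allVecs r) G H) (cong (listSum (allVecs r) G +_) (sym (+-identityʳ _))))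

blockProduct : ∀ {m} (f : Vec Bool m → ℕ) s → Vec Bool (s * m) → ℕ
blockProduct         f zero    ρ = 1
blockProduct {m = m} f (suc s) ρ = f (take m ρ) * blockProduct f s (drop m ρ)

listSum-blockProduct : ∀ {m} (f : Vec Bool m → ℕ) s →
  listSum (allVecs (s * m)) (blockProduct f s) ≡ listSum (allVecs m) f ^ s
listSum-blockProduct         f zero    = refl
listSum-blockProduct {m = m} f (suc s) = begin
  listSum (allVecs (m + s * m)) (blockProduct f (suc s))
    ≡⟨ listSum-allVecs-++ m (s * m) (blockProduct f (suc s)) ⟩
  listSum (allVecs m) (λ x → listSum (allVecs (s * m)) (λ y → f (take m (x Vec.++ y)) * blockProduct f s (drop m (x Vec.++ y))))
    ≡⟨ listSum-cong (allVecs m) (λ x → listSum-cong (allVecs (s * m))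
         (λ y → cong₂ (λ a b → f a * blockProduct f s b) (take-++ x y) (drop-++ x y))) ⟩
  listSum (allVecs m) (λ x → listSum (allVecs (s * m)) (λ y → f x * blockProduct f s y))
    ≡⟨ listSum-cong (allVecs m) (λ x → trans (listSum-*ˡ (allVecs (s * m)) (f x) (blockProduct f s))
                                              (cong (f x *_) (listSum-blockProduct f s))) ⟩
  listSum (allVecs m) (λ x → f x * S ^ s)
    ≡⟨ listSum-cong (allVecs m) (λ x → *-comm (f x) (S ^ s)) ⟩
  listSum (allVecs m) (λ x → S ^ s * f x)
    ≡⟨ listSum-*ˡ (allVecs m) (S ^ s) f ⟩
  S ^ s * S
    ≡⟨ *-comm (S ^ s) S ⟩
  S ^ suc s ∎
  where
  open ≡-Reasoning
  S : ℕ
  S = listSum (allVecs m) f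

^-monoʳ-≤′ : ∀ b {i j} → 1 ≤ i → i ≤ j → b ^ i ≤ b ^ j
^-monoʳ-≤′ zero    (s≤s _) _   = z≤n
^-monoʳ-≤′ (suc b) _       i≤j = ^-monoʳ-≤ (suc b) i≤j

n≤2^n : ∀ n → n ≤ 2 ^ n
n≤2^n zero    = z≤n
n≤2^n (suc n) = begin
  suc n            ≡⟨ +-comm 1 n ⟩
  n + 1            ≤⟨ +-mono-≤ (n≤2^n n) (m^n>0 2 n) ⟩
  2 ^ n + 2 ^ n    ≡⟨ cong (2 ^ n +_) (+-identityʳ (2 ^ n)) ⟨
  2 ^ suc n        ∎
  where open ≤-Reasoning

^-bernoulli : ∀ G X u → G ^ u * (G + X + u * X) ≤ (G + X) ^ suc u
^-bernoulli G X zero    = ≤-reflexive (base G X)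
  where
  base : ∀ G X → 1 * (G + X + 0) ≡ (G + X) * 1
  base = solve-∀
^-bernoulli G X (suc u) = begin
  G ^ suc u * (G + X + suc u * X)       ≡⟨ regroup (G ^ u) G X u ⟩
  G ^ u * (G * (G + X + X + u * X))     ≤⟨ *-monoʳ-≤ (G ^ u) (≤-trans (m≤m+n _ (X * X + u * X * X))
                                                                  (≤-reflexive (expand G X u))) ⟩
  G ^ u * ((G + X) * (G + X + u * X))   ≡⟨ swap (G ^ u) (G + X) (G + X + u * X) ⟩
  (G + X) * (G ^ u * (G + X + u * X))   ≤⟨ *-monoʳ-≤ (G + X) (^-bernoulli G X u) ⟩
  (G + X) ^ suc (suc u)                 ∎
  where
  open ≤-Reasoning
  regroup : ∀ P G X u → G * P * (G + X + (X + u * X)) ≡ P * (G * (G + X + X + u * X))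
  regroup = solve-∀
  expand : ∀ G X u → G * (G + X + X + u * X) + (X * X + u * X * X) ≡ (G + X) * (G + X + u * X)
  expand = solve-∀
  swap : ∀ P N M → P * (N * M) ≡ N * (P * M)
  swap = solve-∀

^-halves : ∀ G X u → G + X ≤ u * X → 0 < G + X → 2 * G ^ u ≤ (G + X) ^ u
^-halves G X u N≤uX N>0 = *-cancelʳ-≤ (2 * G ^ u) ((G + X) ^ u) (G + X) {{>-nonZero N>0}} (begin
  2 * G ^ u * (G + X)               ≡⟨ double (G ^ u) (G + X) ⟩
  G ^ u * (G + X + (G + X))         ≤⟨ *-monoʳ-≤ (G ^ u) (+-monoʳ-≤ (G + X) N≤uX) ⟩
  G ^ u * (G + X + u * X)           ≤⟨ ^-bernoulli G X u ⟩
  (G + X) ^ suc u                   ≡⟨ *-comm (G + X) ((G + X) ^ u) ⟩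
  (G + X) ^ u * (G + X)             ∎)
  where
  open ≤-Reasoning
  double : ∀ P N → 2 * P * N ≡ P * (N + N)
  double = solve-∀

^-quarters : ∀ G N u → 2 * G ^ u ≤ N ^ u → 4 * G ^ (u + u) ≤ N ^ (u + u)
^-quarters G N u 2Gᵘ≤Nᵘ = begin
  4 * G ^ (u + u)           ≡⟨ cong (4 *_) (^-distribˡ-+-* G u u) ⟩
  4 * (G ^ u * G ^ u)       ≡⟨ square (G ^ u) ⟩
  2 * G ^ u * (2 * G ^ u)   ≤⟨ *-mono-≤ 2Gᵘ≤Nᵘ 2Gᵘ≤Nᵘ ⟩
  N ^ u * N ^ u             ≡⟨ ^-distribˡ-+-* N u u ⟨
  N ^ (u + u)               ∎
  where
  open ≤-Reasoning
  square : ∀ P → 4 * (P * P) ≡ 2 * P * (2 * P)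
  square = solve-∀

module _ {n : ℕ} .{{_ : NonZero n}} {B : Fin n → Set} (B? : ∀ x → Dec (B x)) where

  private
    F : ℕ → ℕ
    F y = indicator (B? (y mod n))

    F-periodic : ∀ y → F (n + y) ≡ F y
    F-periodic y = cong (indicator ∘ B?) (toℕ-injective (begin
      toℕ ((n + y) mod n) ≡⟨ toℕ-fromℕ< (m%n<n (n + y) n) ⟩
      (n + y) % n         ≡⟨ cong (_% n) (+-comm n y) ⟩
      (y + n) % n         ≡⟨ [m+n]%n≡m%n y n ⟩
      y % n               ≡⟨ toℕ-fromℕ< (m%n<n y n) ⟨
      toℕ (y mod n)       ∎))
      where open ≡-Reasoning

    F-period : rangeSum n F ≡ ∑[ x < n ] indicator (B? x)
    F-period = trans (rangeSum≡∑ n F) (sum-cong-≗ λ x →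
      cong (indicator ∘ B?) (toℕ-injective (trans (toℕ-fromℕ< (m%n<n (toℕ x) n)) (m<n⇒m%n≡m (toℕ<n x)))))

  mod-sampling : ∀ m → n ≤ 2 ^ m →
    ∑[ x < n ] indicator (B? x) * 2 ^ m ≤ 2 * n * listSum (allVecs m) (λ r → indicator (B? (bitsValue r mod n)))
  mod-sampling m n≤2ᵐ = begin
    size * 2 ^ m                    ≤⟨ *-monoʳ-≤ size 2ᵐ≤2Qn ⟩
    size * (2 * (Q * n))            ≡⟨ rearrange size Q n ⟩
    2 * n * (Q * size)              ≡⟨ cong (λ c → 2 * n * (Q * c)) F-period ⟨
    2 * n * (Q * rangeSum n F)      ≡⟨ cong (2 * n *_) (rangeSum-periodic F F-periodic Q) ⟨
    2 * n * rangeSum (Q * n) F      ≤⟨ *-monoʳ-≤ (2 * n) (rangeSum-mono-length F (m/n*n≤m (2 ^ m) n)) ⟩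
    2 * n * rangeSum (2 ^ m) F      ≡⟨ cong (2 * n *_) (listSum-allVecs-bitsValue m F) ⟨
    2 * n * listSum (allVecs m) (F ∘ bitsValue) ∎
    where
    open ≤-Reasoning
    size Q : ℕ
    size = ∑[ x < n ] indicator (B? x)
    Q = 2 ^ m / n
    rearrange : ∀ c q n → c * (2 * (q * n)) ≡ 2 * n * (q * c)
    rearrange = solve-∀
    2ᵐ≤2Qn : 2 ^ m ≤ 2 * (Q * n)
    2ᵐ≤2Qn = begin
      2 ^ m                   ≡⟨ m≡m%n+[m/n]*n (2 ^ m) n ⟩
      2 ^ m % n + Q * n       ≤⟨ +-monoˡ-≤ (Q * n) (<⇒≤ (m%n<n (2 ^ m) n)) ⟩
      n + Q * n               ≡⟨ cong (_+ Q * n) (*-identityˡ n) ⟨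
      1 * n + Q * n           ≤⟨ +-monoˡ-≤ (Q * n) (*-monoˡ-≤ n (m≥n⇒m/n>0 n≤2ᵐ)) ⟩
      Q * n + Q * n           ≡⟨ cong (Q * n +_) (+-identityʳ (Q * n)) ⟨
      2 * (Q * n)             ∎

two-thirds : ∀ {R O P} → R ≤ O + P → 4 * P ≤ R → 2 * R ≤ 3 * O
two-thirds {R} {O} {P} R≤O+P 4P≤R = *-cancelˡ-≤ 4 (begin
  4 * (2 * R)  ≡⟨ *-assoc 4 2 R ⟨
  8 * R        ≤⟨ *-monoˡ-≤ R (n≤1+n 8) ⟩
  9 * R        ≡⟨ *-assoc 3 3 R ⟩
  3 * (3 * R)  ≤⟨ *-monoʳ-≤ 3 3R≤4O ⟩
  3 * (4 * O)  ≡⟨ *-comm-middle 3 4 O ⟩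
  4 * (3 * O)  ∎)
  where
  open ≤-Reasoning
  3R≤4O : 3 * R ≤ 4 * O
  3R≤4O = +-cancelʳ-≤ R (3 * R) (4 * O) (begin
    3 * R + R        ≡⟨ +-comm (3 * R) R ⟩
    4 * R            ≤⟨ *-monoʳ-≤ 4 R≤O+P ⟩
    4 * (O + P)      ≡⟨ *-distribˡ-+ 4 O P ⟩
    4 * O + 4 * P    ≤⟨ +-monoʳ-≤ (4 * O) 4P≤R ⟩
    4 * O + R        ∎)
  *-comm-middle : ∀ x y z → x * (y * z) ≡ y * (x * z)
  *-comm-middle = solve-∀

-- Short cycles

module _ {n : ℕ} (R : Fin n → Fin n → Set) where

  IsCycle : ∀ m → (Fin (3 + m) → Fin n) → Set
  IsCycle m f = Injective _≡_ _≡_ f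
              × (∀ (i : Fin (2 + m)) → R (f (inject₁ i)) (f (suc i)))
              × R (f (fromℕ (2 + m))) (f zero)

  CycleIn : ℕ → Set
  CycleIn m = Σ (Fin (3 + m) → Fin n) (IsCycle m)

  ShortCycleIn : ℕ → Set
  ShortCycleIn t = ∃ λ m → 3 + m ≤ t × CycleIn m

  ShortCycleThrough : ℕ → Fin n → Set
  ShortCycleThrough t v = ∃ λ m → 3 + m ≤ t × Σ (CycleIn m) (λ c → proj₁ c zero ≡ v)

module _ {n : ℕ} {R S : Fin n → Fin n → Set} (R⇒S : ∀ {x y} → R x y → S x y) where

  cycle-mono : ∀ {m} → CycleIn R m → CycleIn S m
  cycle-mono (f , inj , steps , close) = f , inj , R⇒S ∘ steps , R⇒S close

  shortCycleThrough-mono : ∀ {t v} → ShortCycleThrough R t v → ShortCycleThrough S t v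
  shortCycleThrough-mono (m , m≤t , c , c₀≡v) = m , m≤t , cycle-mono c , c₀≡v

Extensional : ∀ {L n} → ((Fin L → Fin n) → Set) → Set
Extensional P = ∀ {f g} → (∀ x → f x ≡ g x) → P f → P g

cons : ∀ {L n} → Fin n → (Fin L → Fin n) → Fin (suc L) → Fin n
cons x f zero    = x
cons x f (suc i) = f i

∃-function? : ∀ {L n} (P : (Fin L → Fin n) → Set) → Extensional P → (∀ f → Dec (P f)) → Dec (Σ _ P)
∃-function? {zero} P ext P? =
  map′ (λ p → _ , p) (λ (f , p) → ext (λ ()) p) (P? (λ ()))
∃-function? {suc L} P ext P? =
  map′ (λ (x , f , p) → cons x f , p)
       (λ (f , p) → f zero , f ∘ suc , ext cons-head-tail p)
       (any? (λ x → ∃-function? (P ∘ cons x) (λ f≗g → ext (cons-cong f≗g)) (P? ∘ cons x)))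
  where
  cons-cong : ∀ {x f g} → (∀ i → f i ≡ g i) → ∀ i → cons x f i ≡ cons x g i
  cons-cong f≗g zero    = refl
  cons-cong f≗g (suc i) = f≗g i
  cons-head-tail : ∀ {f} i → f i ≡ cons (f zero) (f ∘ suc) i
  cons-head-tail zero    = refl
  cons-head-tail (suc i) = refl

injective? : ∀ {L n} (f : Fin L → Fin n) → Dec (Injective _≡_ _≡_ f)
injective? f = map′ (λ inj {x} {y} → inj x y) (λ inj x y → inj {x} {y})
                    (all? λ x → all? λ y → (f x ≟ f y) →-dec (x ≟ y))

anyCycleLength≤? : {P : ℕ → Set} → (∀ m → Dec (P m)) → ∀ t → Dec (∃ λ m → 3 + m ≤ t × P m)
anyCycleLength≤? P? zero             = no λ { (_ , () , _) }
anyCycleLength≤? P? (suc zero)       = no λ { (_ , s≤s () , _) }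
anyCycleLength≤? P? (suc (suc t)) =
  map′ (λ (m , m<t , p) → m , s≤s (s≤s m<t) , p) (λ { (m , s≤s (s≤s m<t) , p) → m , m<t , p })
       (anyUpTo? P? t)

module _ {n : ℕ} {R : Fin n → Fin n → Set} (R? : ∀ x y → Dec (R x y)) where

  private
    isCycle-ext : ∀ {m} → Extensional (IsCycle R m)
    isCycle-ext {m} f≗g (inj , steps , close) =
      (λ {x} {y} gx≡gy → inj (trans (f≗g x) (trans gx≡gy (sym (f≗g y))))) ,
      (λ i → transport (f≗g (inject₁ i)) (f≗g (suc i)) (steps i)) ,
      transport (f≗g (fromℕ (2 + m))) (f≗g zero) close
      where
      transport : ∀ {a b c d} → a ≡ c → b ≡ d → R a b → R c d
      transport refl refl r = r

    isCycle? : ∀ m f → Dec (IsCycle R m f)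
    isCycle? m f = injective? f ×-dec all? (λ i → R? (f (inject₁ i)) (f (suc i))) ×-dec R? _ _

  shortCycleIn? : ∀ t → Dec (ShortCycleIn R t)
  shortCycleIn? = anyCycleLength≤? (λ m → ∃-function? (IsCycle R m) isCycle-ext (isCycle? m))

  shortCycleThrough? : ∀ t v → Dec (ShortCycleThrough R t v)
  shortCycleThrough? t v = anyCycleLength≤? cycleThrough? t
    where
    cycleThrough? : ∀ m → Dec (Σ (CycleIn R m) (λ c → proj₁ c zero ≡ v))
    cycleThrough? m =
      map′ (λ (f , c , f₀≡v) → (f , c) , f₀≡v) (λ ((f , c) , f₀≡v) → f , c , f₀≡v)
           (∃-function? (λ f → IsCycle R m f × f zero ≡ v)
                        (λ f≗g (c , f₀≡v) → isCycle-ext f≗g c , trans (sym (f≗g zero)) f₀≡v)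
                        (λ f → isCycle? m f ×-dec (f zero ≟ v)))

-- Walks and query histories

follow : ∀ {n d} → Rep n d → Fin n → ∀ {ℓ} → Vec (Fin d) ℓ → Maybe (Fin n)
follow g v []      = just v
follow g v (i ∷ σ) = follow g v σ >>= λ x → g x i

allPortSeqs : ∀ {d} ℓ → List (Vec (Fin d) ℓ)
allPortSeqs zero    = [] ∷ []
allPortSeqs (suc ℓ) = concatMap (λ σ → map (_∷ σ) (allFin _)) (allPortSeqs ℓ)

∈-allPortSeqs : ∀ {d ℓ} (σ : Vec (Fin d) ℓ) → σ ∈ allPortSeqs ℓ
∈-allPortSeqs []      = here refl
∈-allPortSeqs (i ∷ σ) = ∈-concatMap (∈-map⁺ (_∷ σ) (∈-allFin i)) (∈-allPortSeqs σ)

length-allPortSeqs : ∀ d ℓ → length (allPortSeqs {d} ℓ) ≡ d ^ ℓ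
length-allPortSeqs d zero    = refl
length-allPortSeqs d (suc ℓ) = begin
  length (allPortSeqs {d} (suc ℓ))
    ≡⟨ length-concatMap _ (allPortSeqs ℓ) ⟩
  listSum (allPortSeqs ℓ) (λ σ → length (map (_∷ σ) (allFin d)))
    ≡⟨ listSum-cong (allPortSeqs ℓ) (λ σ → trans (length-map _ (allFin d)) (length-tabulate _)) ⟩
  listSum (allPortSeqs ℓ) (λ _ → d)
    ≡⟨ listSum-const (allPortSeqs ℓ) d ⟩
  length (allPortSeqs {d} ℓ) * d
    ≡⟨ cong (_* d) (length-allPortSeqs d ℓ) ⟩
  d ^ ℓ * d
    ≡⟨ *-comm (d ^ ℓ) d ⟩
  d ^ suc ℓ ∎
  where open ≡-Reasoning

adj? : ∀ {n d} (g : Rep n d) x y → Dec (Adj g x y)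
adj? g x y = any? (λ i → Maybe.≡-dec _≟_ (g x i) (just y))

answer : ∀ {n d} → History n d → Rep n d
answer []            x i = nothing
answer ((q , a) ∷ h) x i with Product.≡-dec _≟_ _≟_ q (x , i)
... | yes _ = a
... | no  _ = answer h x i

SeenAdj : ∀ {n d} → History n d → Fin n → Fin n → Set
SeenAdj h x y = Adj (answer h) x y ⊎ Adj (answer h) y x

seenAdj? : ∀ {n d} (h : History n d) x y → Dec (SeenAdj h x y)
seenAdj? h x y = adj? (answer h) x y ⊎-dec adj? (answer h) y x

module _ {n d : ℕ} (g : Rep n d) where

  Reaches : ℕ → Fin n → Fin n → Set
  Reaches ℓ v y = Σ (Vec (Fin d) ℓ) λ σ → follow g v σ ≡ just y

  Near : ℕ → Fin n → Fin n → Set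
  Near k v y = ∃ λ ℓ → ℓ ≤ k × Reaches ℓ v y

  reaches-step : ∀ {ℓ v x y} → Reaches ℓ v x → Adj g x y → Reaches (suc ℓ) v y
  reaches-step (σ , σ↝x) (i , gxi≡y) = (i ∷ σ) , trans (cong (_>>= λ x → g x i) σ↝x) gxi≡y

module _ {n d : ℕ} {g : Rep n d} (adj-sym : ∀ {x y} → Adj g x y → Adj g y x) {M : ℕ}
         (f : Fin (suc M) → Fin n)
         (steps : ∀ (i : Fin M) → Adj g (f (inject₁ i)) (f (suc i)))
         (close : Adj g (f (fromℕ M)) (f zero)) where

  private
    forward : ∀ i → Reaches g (toℕ i) (f zero) (f i)
    forward = <-weakInduction (λ i → Reaches g (toℕ i) (f zero) (f i)) ([] , refl) λ i reach →
      reaches-step g (subst (λ ℓ → Reaches g ℓ (f zero) (f (inject₁ i))) (toℕ-inject₁ i) reach) (steps i)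

    backward : ∀ i → Reaches g (suc M ∸ toℕ i) (f zero) (f i)
    backward = >-weakInduction (λ i → Reaches g (suc M ∸ toℕ i) (f zero) (f i))
      (subst (λ ℓ → Reaches g ℓ (f zero) (f (fromℕ M))) (sym last-distance)
             (reaches-step g ([] , refl) (adj-sym close)))
      λ i reach → subst (λ ℓ → Reaches g ℓ (f zero) (f (inject₁ i))) (distance-inject₁ i)
                        (reaches-step g reach (adj-sym (steps i)))
      where
      last-distance : suc M ∸ toℕ (fromℕ M) ≡ 1
      last-distance = trans (cong (suc M ∸_) (toℕ-fromℕ M)) (m+n∸n≡m 1 M)
      distance-inject₁ : ∀ (i : Fin M) → suc (M ∸ toℕ i) ≡ suc M ∸ toℕ (inject₁ i)
      distance-inject₁ i = trans (sym (+-∸-assoc 1 (<⇒≤ (toℕ<n i)))) (cong (suc M ∸_) (sym (toℕ-inject₁ i)))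

  closedWalk-edge-near : ∀ {k} → M ≤ k + suc k → ∀ (i : Fin M) →
    Near g k (f zero) (f (inject₁ i)) ⊎ Near g k (f zero) (f (suc i))
  closedWalk-edge-near {k} M≤2k+1 i with toℕ i ≤? k
  ... | yes i≤k = inj₁ (toℕ (inject₁ i) , subst (_≤ k) (sym (toℕ-inject₁ i)) i≤k , forward (inject₁ i))
  ... | no  i≰k = inj₂ (M ∸ toℕ i , M-i≤k , backward (suc i))
    where
    M-i≤k : M ∸ toℕ i ≤ k
    M-i≤k = begin
      M ∸ toℕ i             ≤⟨ ∸-mono M≤2k+1 (≰⇒> i≰k) ⟩
      k + suc k ∸ suc k     ≡⟨ m+n∸n≡m k (suc k) ⟩
      k                     ∎
      where open ≤-Reasoning

module _ {n d : ℕ} (g : Rep n d) where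

  Truthful : History n d → Set
  Truthful h = ∀ {x i a} → ((x , i) , a) ∈ h → a ≡ g x i

  Answered : History n d → Fin n → Set
  Answered h x = ∀ i → ((x , i) , g x i) ∈ h

  runRounds-truthful : ∀ (A : Tester n d) ρ ℓ → Truthful (runRounds A g ρ ℓ)
  runRounds-truthful A ρ zero    ()
  runRounds-truthful A ρ (suc ℓ) e∈ with ∈-++⁻ (runRounds A g ρ ℓ) e∈
  ... | inj₁ e∈h = runRounds-truthful A ρ ℓ e∈h
  ... | inj₂ e∈new with ∈-map⁻ _ e∈new
  ...   | _ , _ , refl = refl

  answer-sound : ∀ {h} → Truthful h → ∀ {x y} → Adj (answer h) x y → Adj g x y
  answer-sound {[]}          truth (i , ())
  answer-sound {(q , a) ∷ h} truth {x} (i , answer≡y) with Product.≡-dec _≟_ _≟_ q (x , i)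
  ... | yes refl = i , trans (sym (truth (here refl))) answer≡y
  ... | no  _    = answer-sound (truth ∘ there) (i , answer≡y)

  answer-complete : ∀ {h} → Truthful h → ∀ {x i} → ((x , i) , g x i) ∈ h → answer h x i ≡ g x i
  answer-complete {(q , a) ∷ h} truth {x} {i} e∈ with Product.≡-dec _≟_ _≟_ q (x , i)
  ... | yes refl = truth (here refl)
  ... | no  q≢xi with e∈
  ...   | here refl = contradiction refl q≢xi
  ...   | there e∈h = answer-complete (truth ∘ there) e∈h

  Explored : History n d → Fin n → ℕ → Set
  Explored h v ℓ = ∀ {ℓ′ y} → ℓ′ < ℓ → Reaches g ℓ′ v y → Answered h y

  follow-answer : ∀ {h} → Truthful h → ∀ {v ℓ} → Explored h v ℓ →
    (σ : Vec (Fin d) ℓ) → follow (answer h) v σ ≡ follow g v σ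
  follow-answer truth explored [] = refl
  follow-answer {h} truth {v} {suc ℓ} explored (i ∷ σ) = begin
    (follow (answer h) v σ >>= λ x → answer h x i)
      ≡⟨ cong (_>>= λ x → answer h x i) (follow-answer truth (explored ∘ m<n⇒m<1+n) σ) ⟩
    (follow g v σ >>= λ x → answer h x i)
      ≡⟨ answered-step (follow g v σ) refl ⟩
    (follow g v σ >>= λ x → g x i) ∎
    where
    open ≡-Reasoning
    answered-step : ∀ r → follow g v σ ≡ r → (r >>= λ x → answer h x i) ≡ (r >>= λ x → g x i)
    answered-step nothing  _    = refl
    answered-step (just y) σ↝y = answer-complete truth (explored (n<1+n ℓ) (σ , σ↝y) i)

-- Removing an edge

occupied : Maybe A → ℕ
occupied nothing  = 0
occupied (just _) = 1

differ : ∀ {n} → Maybe (Fin n) → Maybe (Fin n) → ℕ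
differ a b = indicator (¬? (Maybe.≡-dec _≟_ a b))

differ-self : ∀ {n} (a : Maybe (Fin n)) → differ a a ≡ 0
differ-self a with Maybe.≡-dec _≟_ a a
... | yes _   = refl
... | no  a≢a = contradiction refl a≢a

differ≤1 : ∀ {n} (a b : Maybe (Fin n)) → differ a b ≤ 1
differ≤1 a b with Maybe.≡-dec _≟_ a b
... | yes _ = z≤n
... | no  _ = s≤s z≤n

differ-triangle : ∀ {n} (a b c : Maybe (Fin n)) → differ a c ≤ differ a b + differ b c
differ-triangle a b c with Maybe.≡-dec _≟_ a b
... | no _    = ≤-trans (differ≤1 a c) (s≤s z≤n)
... | yes refl = ≤-refl

module RowRemoval {n d : ℕ} (h : Fin d → Maybe (Fin n))
                  (prefix : ∀ p q → p Fin.≤ q → h p ≡ nothing → h q ≡ nothing)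
                  (noRepeat : ∀ p q z → h p ≡ just z → h q ≡ just z → p ≡ q) where

  Filled : Fin d → Set
  Filled p = ∃ λ z → h p ≡ just z

  LastFilled : Fin d → Set
  LastFilled l = Filled l × (∀ q → l Fin.< q → h q ≡ nothing)

  lastFilled : ∀ {i} → Filled i → Σ (Fin d) LastFilled
  lastFilled {i} = search i (>-wellFounded i)
    where
    filled? : ∀ q → Dec (Filled q)
    filled? q with h q
    ... | nothing = no λ ()
    ... | just z  = yes (z , refl)
    search : ∀ i → Acc Fin._>_ i → Filled i → Σ (Fin d) LastFilled
    search i (acc rec) filled-i with any? (λ q → (i <? q) ×-dec filled? q)
    ... | yes (q , i<q , filled-q) = search q (rec i<q) filled-q
    ... | no  none = i , filled-i , empty
      where
      empty : ∀ q → i Fin.< q → h q ≡ nothing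
      empty q i<q with h q in hq
      ... | nothing = refl
      ... | just z  = contradiction (q , i<q , z , hq) none

  -- The last filled slot l moves into the freed slot i: the neighbours still fill a prefix of
  -- the slots, and only slots i and l change.
  removeSlot : Fin d → Fin d → Fin d → Maybe (Fin n)
  removeSlot i l p with p ≟ l | p ≟ i
  ... | yes _ | _     = nothing
  ... | no  _ | yes _ = h l
  ... | no  _ | no  _ = h p

  module _ {i y} (hi : h i ≡ just y) {l} (last : LastFilled l) where

    private
      h′ : Fin d → Maybe (Fin n)
      h′ = removeSlot i l

      z₀ : Fin n
      z₀ = proj₁ (proj₁ last)
      hl : h l ≡ just z₀
      hl = proj₂ (proj₁ last)

      i≤l : i Fin.≤ l
      i≤l with i Finₚ.≤? l
      ... | yes i≤l = i≤l
      ... | no  i≰l = contradiction (trans (sym hi) (proj₂ last i (≰⇒> i≰l))) λ ()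

      source : Fin d → Fin d
      source p with p ≟ i
      ... | yes _ = l
      ... | no  _ = p

      removeSlot-source : ∀ {p z} → h′ p ≡ just z → p ≢ l × h (source p) ≡ just z
      removeSlot-source {p} h′p with p ≟ l | p ≟ i
      ... | no p≢l | yes _ = p≢l , h′p
      ... | no p≢l | no  _ = p≢l , h′p

      source-injective : ∀ {p q} → p ≢ l → q ≢ l → source p ≡ source q → p ≡ q
      source-injective {p} {q} p≢l q≢l eq with p ≟ i | q ≟ i
      ... | yes p≡i | yes q≡i = trans p≡i (sym q≡i)
      ... | yes _   | no  _   = contradiction (sym eq) q≢l
      ... | no  _   | yes _   = contradiction eq p≢l
      ... | no  _   | no  _   = eq

    removeSlot-noRepeat : ∀ p q z → h′ p ≡ just z → h′ q ≡ just z → p ≡ q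
    removeSlot-noRepeat p q z h′p h′q with removeSlot-source h′p | removeSlot-source h′q
    ... | p≢l , hsp | q≢l , hsq = source-injective p≢l q≢l (noRepeat _ _ z hsp hsq)

    removeSlot-lists⁻ : ∀ {p z} → h′ p ≡ just z → (∃ λ q → h q ≡ just z) × z ≢ y
    removeSlot-lists⁻ {p} h′p with p ≟ l | p ≟ i
    ... | no p≢l | yes p≡i = (l , h′p) , λ { refl → p≢l (trans p≡i (noRepeat i l y hi h′p)) }
    ... | no p≢l | no  p≢i = (p , h′p) , λ { refl → p≢i (noRepeat p i y h′p hi) }

    removeSlot-lists⁺ : ∀ {q z} → h q ≡ just z → z ≢ y → ∃ λ p → h′ p ≡ just z
    removeSlot-lists⁺ {q} hq z≢y with q ≟ l
    ... | yes refl = i , moved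
      where
      moved : h′ i ≡ just _
      moved with i ≟ q | i ≟ i
      ... | yes refl | _      = contradiction (just-injective (trans (sym hq) hi)) z≢y
      ... | no  _    | yes _  = hq
      ... | no  _    | no i≢i = contradiction refl i≢i
    ... | no q≢l = q , kept
      where
      kept : h′ q ≡ just _
      kept with q ≟ l | q ≟ i
      ... | yes q≡l | _       = contradiction q≡l q≢l
      ... | no  _   | yes refl = contradiction (just-injective (trans (sym hq) hi)) z≢y
      ... | no  _   | no  _   = hq

    removeSlot-prefix : ∀ p q → p Fin.≤ q → h′ p ≡ nothing → h′ q ≡ nothing
    removeSlot-prefix p q p≤q h′p with q ≟ l | q ≟ i
    ... | yes _   | _        = refl
    ... | no  q≢l | yes refl = contradiction h′p (filledUpTo-i p p≤q)
      where
      filledUpTo-i : ∀ p → p Fin.≤ q → h′ p ≢ nothing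
      filledUpTo-i p p≤i with p ≟ l | p ≟ i
      ... | yes refl | _     = contradiction (Finₚ.≤-antisym i≤l p≤i) q≢l
      ... | no  _    | yes _ = λ hl≡nothing → contradiction (trans (sym hl) hl≡nothing) λ ()
      ... | no  _    | no  _ = λ hp≡nothing → contradiction (trans (sym hi) (prefix p i p≤i hp≡nothing)) λ ()
    ... | no  q≢l | no  _    = emptied p p≤q h′p
      where
      emptied : ∀ p → p Fin.≤ q → h′ p ≡ nothing → h q ≡ nothing
      emptied p p≤q h′p with p ≟ l | p ≟ i
      ... | yes refl | _     = proj₂ last q (Finₚ.≤∧≢⇒< p≤q (q≢l ∘ sym))
      ... | no  _    | yes _ = contradiction (trans (sym hl) h′p) λ ()
      ... | no  _    | no  _ = prefix p q p≤q h′p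

    removeSlot-degree : ∑[ p < d ] occupied (h′ p) + 1 ≡ ∑[ p < d ] occupied (h p)
    removeSlot-degree = begin
      ∑[ p < d ] occupied (h′ p) + 1
        ≡⟨ cong (∑[ p < d ] occupied (h′ p) +_) (∑-indicator-≟ l) ⟨
      ∑[ p < d ] occupied (h′ p) + ∑[ p < d ] indicator (p ≟ l)
        ≡⟨ ∑-distrib-+ (occupied ∘ h′) (λ p → indicator (p ≟ l)) ⟨
      ∑[ p < d ] (occupied (h′ p) + indicator (p ≟ l))
        ≡⟨ sum-cong-≗ pointwise ⟩
      ∑[ p < d ] occupied (h p) ∎
      where
      open ≡-Reasoning
      pointwise : ∀ p → occupied (h′ p) + indicator (p ≟ l) ≡ occupied (h p)
      pointwise p with p ≟ l | p ≟ i
      ... | yes refl | _        = cong occupied (sym hl)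
      ... | no  _    | yes refl = trans (+-identityʳ _) (trans (cong occupied hl) (cong occupied (sym hi)))
      ... | no  _    | no  _    = +-identityʳ _

    removeSlot-differ : ∑[ p < d ] differ (h p) (h′ p) ≤ 2
    removeSlot-differ = begin
      ∑[ p < d ] differ (h p) (h′ p)
        ≤⟨ ∑-mono pointwise ⟩
      ∑[ p < d ] (indicator (p ≟ i) + indicator (p ≟ l))
        ≡⟨ ∑-distrib-+ (λ p → indicator (p ≟ i)) (λ p → indicator (p ≟ l)) ⟩
      ∑[ p < d ] indicator (p ≟ i) + ∑[ p < d ] indicator (p ≟ l)
        ≡⟨ cong₂ _+_ (∑-indicator-≟ i) (∑-indicator-≟ l) ⟩
      2 ∎
      where
      open ≤-Reasoning
      pointwise : ∀ p → differ (h p) (h′ p) ≤ indicator (p ≟ i) + indicator (p ≟ l)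
      pointwise p with p ≟ l | p ≟ i
      ... | yes _ | _     = ≤-trans (differ≤1 (h p) nothing) (m≤n+m 1 _)
      ... | no  _ | yes _ = differ≤1 (h p) (h l)
      ... | no  _ | no  _ = ≤-reflexive (differ-self (h p))

degree : ∀ {n d} → Rep n d → Fin n → ℕ
degree {d = d} g x = ∑[ p < d ] occupied (g x p)

degree≤ : ∀ {n d} (g : Rep n d) x → degree g x ≤ d
degree≤ {d = d} g x = ≤-trans (∑-mono (occupied≤1 ∘ g x)) (≤-reflexive (trans (∑-const d 1) (*-identityʳ d)))
  where
  occupied≤1 : ∀ (a : Maybe A) → occupied a ≤ 1
  occupied≤1 nothing  = z≤n
  occupied≤1 (just _) = s≤s z≤n

rowDistance : ∀ {n d} → Rep n d → Rep n d → Fin n → ℕ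
rowDistance {d = d} g g′ x = ∑[ p < d ] differ (g x p) (g′ x p)

distance : ∀ {n d} → Rep n d → Rep n d → ℕ
distance {n} g g′ = ∑[ x < n ] rowDistance g g′ x

module EdgeRemoval {n d : ℕ} {g : Rep n d} (valid : Valid g) {v w : Fin n} {i j : Fin d}
                   (gvi : g v i ≡ just w) (gwj : g w j ≡ just v) where

  open Valid valid
  module Rv = RowRemoval (g v) (prefix v) (noRepeat v)
  module Rw = RowRemoval (g w) (prefix w) (noRepeat w)

  private
    lastV : Σ (Fin d) Rv.LastFilled
    lastV = Rv.lastFilled (w , gvi)
    lastW : Σ (Fin d) Rw.LastFilled
    lastW = Rw.lastFilled (v , gwj)

  g′ : Rep n d
  g′ x with x ≟ v | x ≟ w
  ... | yes _ | _     = Rv.removeSlot i (proj₁ lastV)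
  ... | no  _ | yes _ = Rw.removeSlot j (proj₁ lastW)
  ... | no  _ | no  _ = g x

  v≢w : v ≢ w
  v≢w refl = noLoop v i gvi

  SameEdge : Fin n → Fin n → Set
  SameEdge x z = (x ≡ v × z ≡ w) ⊎ (x ≡ w × z ≡ v)

  removeEdge-adj⁻ : ∀ {x z} → Adj g′ x z → Adj g x z × ¬ SameEdge x z
  removeEdge-adj⁻ {x} {z} (p , g′xp) with x ≟ v | x ≟ w
  ... | yes refl | _ with Rv.removeSlot-lists⁻ gvi (proj₂ lastV) {p} g′xp
  ...   | listed , z≢w = listed , λ { (inj₁ (_ , z≡w)) → z≢w z≡w ; (inj₂ (v≡w , _)) → v≢w v≡w }
  removeEdge-adj⁻ {x} {z} (p , g′xp) | no x≢v | yes refl with Rw.removeSlot-lists⁻ gwj (proj₂ lastW) {p} g′xp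
  ...   | listed , z≢v = listed , λ { (inj₁ (w≡v , _)) → x≢v w≡v ; (inj₂ (_ , z≡v)) → z≢v z≡v }
  removeEdge-adj⁻ {x} {z} (p , g′xp) | no x≢v | no x≢w =
    (p , g′xp) , λ { (inj₁ (x≡v , _)) → x≢v x≡v ; (inj₂ (x≡w , _)) → x≢w x≡w }

  removeEdge-adj⁺ : ∀ {x z} → Adj g x z → ¬ SameEdge x z → Adj g′ x z
  removeEdge-adj⁺ {x} {z} (p , gxp) other with x ≟ v | x ≟ w
  ... | yes refl | _        = Rv.removeSlot-lists⁺ gvi (proj₂ lastV) gxp (λ z≡w → other (inj₁ (refl , z≡w)))
  ... | no  _    | yes refl = Rw.removeSlot-lists⁺ gwj (proj₂ lastW) gxp (λ z≡v → other (inj₂ (refl , z≡v)))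
  ... | no  _    | no  _    = p , gxp

  removeEdge-valid : Valid g′
  removeEdge-valid = record
    { prefix    = prefix′
    ; noLoop    = λ x p g′xp → noLoop x _ (proj₂ (proj₁ (removeEdge-adj⁻ (p , g′xp))))
    ; noRepeat  = noRepeat′
    ; symmetric = λ x z p g′xp → symmetric′ (removeEdge-adj⁻ (p , g′xp))
    }
    where
    prefix′ : ∀ x p q → p Fin.≤ q → g′ x p ≡ nothing → g′ x q ≡ nothing
    prefix′ x with x ≟ v | x ≟ w
    ... | yes refl | _        = Rv.removeSlot-prefix gvi (proj₂ lastV)
    ... | no  _    | yes refl = Rw.removeSlot-prefix gwj (proj₂ lastW)
    ... | no  _    | no  _    = prefix x
    noRepeat′ : ∀ x p q z → g′ x p ≡ just z → g′ x q ≡ just z → p ≡ q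
    noRepeat′ x with x ≟ v | x ≟ w
    ... | yes refl | _        = Rv.removeSlot-noRepeat gvi (proj₂ lastV)
    ... | no  _    | yes refl = Rw.removeSlot-noRepeat gwj (proj₂ lastW)
    ... | no  _    | no  _    = noRepeat x
    symmetric′ : ∀ {x z} → Adj g x z × ¬ SameEdge x z → Adj g′ z x
    symmetric′ ((p , gxp) , other) =
      removeEdge-adj⁺ (symmetric _ _ p gxp) λ { (inj₁ (z≡v , x≡w)) → other (inj₂ (x≡w , z≡v))
                                              ; (inj₂ (z≡w , x≡v)) → other (inj₁ (x≡v , z≡w)) }

  removeEdge-degree : ∀ x → degree g′ x + indicator (x ≟ v) ≤ degree g x
  removeEdge-degree x with x ≟ v | x ≟ w
  ... | yes refl | _        = ≤-reflexive (Rv.removeSlot-degree gvi (proj₂ lastV))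
  ... | no  _    | yes refl = ≤-trans (≤-reflexive (+-identityʳ _))
                                      (≤-trans (m≤m+n _ 1) (≤-reflexive (Rw.removeSlot-degree gwj (proj₂ lastW))))
  ... | no  _    | no  _    = ≤-reflexive (+-identityʳ _)

  removeEdge-rowDistance : ∀ x → rowDistance g g′ x ≤ 2 * indicator (x ≟ v) + 2 * indicator (x ≟ w)
  removeEdge-rowDistance x with x ≟ v | x ≟ w
  ... | yes refl | _        = ≤-trans (Rv.removeSlot-differ gvi (proj₂ lastV)) (m≤m+n 2 _)
  ... | no  _    | yes refl = Rw.removeSlot-differ gwj (proj₂ lastW)
  ... | no  _    | no  _    = ≤-reflexive (trans (sum-cong-≗ (differ-self ∘ g x)) (trans (∑-const d 0) (*-zeroʳ d)))

  removeEdge-distance : distance g g′ ≤ 4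
  removeEdge-distance = begin
    distance g g′
      ≤⟨ ∑-mono removeEdge-rowDistance ⟩
    ∑[ x < n ] (2 * indicator (x ≟ v) + 2 * indicator (x ≟ w))
      ≡⟨ ∑-distrib-+ (λ x → 2 * indicator (x ≟ v)) (λ x → 2 * indicator (x ≟ w)) ⟩
    ∑[ x < n ] (2 * indicator (x ≟ v)) + ∑[ x < n ] (2 * indicator (x ≟ w))
      ≡⟨ cong₂ _+_ (∑-scaled-indicator v) (∑-scaled-indicator w) ⟩
    4 ∎
    where
    open ≤-Reasoning
    ∑-scaled-indicator : ∀ u → ∑[ x < n ] (2 * indicator (x ≟ u)) ≡ 2
    ∑-scaled-indicator u = trans (sym (*-distribˡ-sum 2 (λ x → indicator (x ≟ u)))) (cong (2 *_) (∑-indicator-≟ u))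

module _ {n d : ℕ} where

  distance-self : ∀ (g : Rep n d) → distance g g ≡ 0
  distance-self g = trans (sum-cong-≗ rowZero) (trans (∑-const n 0) (*-zeroʳ n))
    where
    rowZero : ∀ x → rowDistance g g x ≡ 0
    rowZero x = trans (sum-cong-≗ (differ-self ∘ g x)) (trans (∑-const d 0) (*-zeroʳ d))

  distance-triangle : ∀ (g g′ g″ : Rep n d) → distance g g″ ≤ distance g g′ + distance g′ g″
  distance-triangle g g′ g″ =
    ≤-trans (∑-mono rowTriangle) (≤-reflexive (∑-distrib-+ (rowDistance g g′) (rowDistance g′ g″)))
    where
    rowTriangle : ∀ x → rowDistance g g″ x ≤ rowDistance g g′ x + rowDistance g′ g″ x
    rowTriangle x = ≤-trans (∑-mono (λ p → differ-triangle (g x p) (g′ x p) (g″ x p)))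
                            (≤-reflexive (∑-distrib-+ (λ p → differ (g x p) (g′ x p)) (λ p → differ (g′ x p) (g″ x p))))

  diffCount≡distance : ∀ (g g′ : Rep n d) → diffCount g g′ ≡ distance g g′
  diffCount≡distance g g′ = begin
    diffCount g g′
      ≡⟨ length-filter≡listSum differ? (cartesianProduct (allFin n) (allFin d)) ⟩
    listSum (cartesianProduct (allFin n) (allFin d)) (indicator ∘ differ?)
      ≡⟨ listSum-cartesianProduct (allFin n) (allFin d) (indicator ∘ differ?) ⟩
    listSum (allFin n) (λ x → listSum (allFin d) (λ p → differ (g x p) (g′ x p)))
      ≡⟨ listSum-allFin (λ x → listSum (allFin d) (λ p → differ (g x p) (g′ x p))) ⟩
    ∑[ x < n ] listSum (allFin d) (λ p → differ (g x p) (g′ x p))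
      ≡⟨ sum-cong-≗ (λ x → listSum-allFin (λ p → differ (g x p) (g′ x p))) ⟩
    distance g g′ ∎
    where
    open ≡-Reasoning
    differ? : ∀ (q : Fin n × Fin d) → Dec (g (proj₁ q) (proj₂ q) ≢ g′ (proj₁ q) (proj₂ q))
    differ? (x , p) = ¬? (Maybe.≡-dec _≟_ (g x p) (g′ x p))

-- Far graphs have many vertices on short cycles

module Repair {n d : ℕ} (t : ℕ) where

  Bad : Rep n d → Fin n → Set
  Bad g = ShortCycleThrough (Adj g) t

  -- Opaque: unfolding the exhaustive cycle search makes type checking prohibitively slow.
  opaque
    bad? : ∀ g x → Dec (Bad g x)
    bad? g = shortCycleThrough? (adj? g) t

  badCount : Rep n d → ℕ
  badCount g = ∑[ x < n ] indicator (bad? g x)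

  badDegree : Rep n d → ℕ
  badDegree g = ∑[ x < n ] (indicator (bad? g x) * degree g x)

  badDegree≤ : ∀ g → badDegree g ≤ d * badCount g
  badDegree≤ g = begin
    ∑[ x < n ] (indicator (bad? g x) * degree g x) ≤⟨ ∑-mono (λ x → *-monoʳ-≤ (indicator (bad? g x)) (degree≤ g x)) ⟩
    ∑[ x < n ] (indicator (bad? g x) * d)           ≡⟨ sum-cong-≗ (λ x → *-comm (indicator (bad? g x)) d) ⟩
    ∑[ x < n ] (d * indicator (bad? g x))           ≡⟨ *-distribˡ-sum d (indicator ∘ bad? g) ⟨
    d * badCount g                                  ∎
    where open ≤-Reasoning

  removeBadEdge : ∀ {g} → Valid g → ShortCycleIn (Adj g) t →
    Σ (Rep n d) λ g′ → Valid g′ × distance g g′ ≤ 4 × badDegree g′ < badDegree g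
  removeBadEdge {g} valid (m₀ , 3+m₀≤t , cycle@(f , _ , steps , _)) =
    g′ , removeEdge-valid , removeEdge-distance , decreases
    where
    v : Fin n
    v = f zero

    firstEdge : Adj g v (f (suc zero))
    firstEdge = steps zero

    open EdgeRemoval valid (proj₂ firstEdge) (proj₂ (Valid.symmetric valid _ _ _ (proj₂ firstEdge)))

    badV : Bad g v
    badV = m₀ , 3+m₀≤t , cycle , refl

    stillBad : ∀ {x} → Bad g′ x → Bad g x
    stillBad = shortCycleThrough-mono {S = Adj g} (λ xz → proj₁ (removeEdge-adj⁻ xz))

    D : Fin n → ℕ
    D x = indicator (bad? g x) * degree g′ x

    drops-at-v : ∀ x → D x + indicator (x ≟ v) ≤ indicator (bad? g x) * degree g x
    drops-at-v x with x ≟ v | removeEdge-degree x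
    ... | no  _    | deg≤ = ≤-trans (≤-reflexive (+-identityʳ _))
                                    (*-monoʳ-≤ (indicator (bad? g x)) (≤-trans (m≤m+n _ 0) deg≤))
    ... | yes refl | deg≤ with bad? g x
    ...   | yes _   = subst₂ _≤_ (cong (_+ 1) (sym (+-identityʳ _))) (sym (+-identityʳ _)) deg≤
    ...   | no ¬bad = contradiction badV ¬bad

    decreases : badDegree g′ < badDegree g
    decreases = begin-strict
      badDegree g′                                    <⟨ m<m+n _ (s≤s z≤n) ⟩
      badDegree g′ + 1                                ≤⟨ +-monoˡ-≤ 1 (∑-mono λ x → *-monoˡ-≤ (degree g′ x)
                                                           (indicator-mono stillBad (bad? g′ x) (bad? g x))) ⟩
      ∑[ x < n ] D x + 1                              ≡⟨ cong (∑[ x < n ] D x +_) (∑-indicator-≟ v) ⟨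
      ∑[ x < n ] D x + ∑[ x < n ] indicator (x ≟ v)   ≡⟨ ∑-distrib-+ D (λ x → indicator (x ≟ v)) ⟨
      ∑[ x < n ] (D x + indicator (x ≟ v))            ≤⟨ ∑-mono drops-at-v ⟩
      badDegree g                                     ∎
      where open ≤-Reasoning

  repair : ∀ {g} → Valid g → Σ (Rep n d) λ g′ → Valid g′ × CycleFree t g′ × distance g g′ ≤ 4 * badDegree g
  repair {g} valid = go g valid (<-wellFounded (badDegree g))
    where
    go : ∀ g → Valid g → Acc _<_ (badDegree g) →
      Σ (Rep n d) λ g′ → Valid g′ × CycleFree t g′ × distance g g′ ≤ 4 * badDegree g
    go g valid (acc rec) with shortCycleIn? (adj? g) t
    ... | no noCycle = g , valid , (λ m 3+m≤t c → noCycle (m , 3+m≤t , c)) , ≤-trans (≤-reflexive (distance-self g)) z≤n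
    ... | yes cycle with removeBadEdge valid cycle
    ...   | g₁ , valid₁ , dist≤4 , smaller with go g₁ valid₁ (rec smaller)
    ...     | g′ , valid′ , free , dist′ = g′ , valid′ , free , (begin
      distance g g′                   ≤⟨ distance-triangle g g₁ g′ ⟩
      distance g g₁ + distance g₁ g′  ≤⟨ +-mono-≤ dist≤4 dist′ ⟩
      4 + 4 * badDegree g₁            ≡⟨ *-distribˡ-+ 4 1 (badDegree g₁) ⟨
      4 * suc (badDegree g₁)          ≤⟨ *-monoʳ-≤ 4 smaller ⟩
      4 * badDegree g                 ∎)
      where open ≤-Reasoning

  far⇒manyBad : ∀ {a b g} → Valid g → FarFromCycleFree t a b g → a * n < b * (4 * badCount g)
  far⇒manyBad {a} {b} {g} valid far with repair valid
  ... | g′ , valid′ , free , dist≤ = *-cancelˡ-< d (a * n) (b * (4 * badCount g)) (begin-strict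
    d * (a * n)               ≡⟨ swap d a n ⟩
    a * (d * n)               <⟨ far g′ valid′ free ⟩
    b * diffCount g g′        ≡⟨ cong (b *_) (diffCount≡distance g g′) ⟩
    b * distance g g′         ≤⟨ *-monoʳ-≤ b (≤-trans dist≤ (*-monoʳ-≤ 4 (badDegree≤ g))) ⟩
    b * (4 * (d * badCount g)) ≡⟨ swap-scaled b d (badCount g) ⟩
    d * (b * (4 * badCount g)) ∎)
    where
    open ≤-Reasoning
    swap : ∀ x y z → x * (y * z) ≡ y * (x * z)
    swap = solve-∀
    swap-scaled : ∀ x y z → x * (4 * (y * z)) ≡ y * (x * (4 * z))
    swap-scaled = solve-∀

-- The tester

module Explorer {n : ℕ} .{{_ : NonZero n}} (d k t m s : ℕ) where

  sampleVertex : Vec Bool m → Fin n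
  sampleVertex x = bitsValue x mod n

  samples : ∀ r → Vec Bool (r * m) → List (Fin n)
  samples zero    ρ = []
  samples (suc r) ρ = sampleVertex (take m ρ) ∷ samples r (drop m ρ)

  slotsOf : Fin n → List (Query n d)
  slotsOf x = map (x ,_) (allFin d)

  -- A port sequence that runs into an empty slot has no endpoint; for it v is queried again.
  exploreFrom : ℕ → History n d → Fin n → List (Query n d)
  exploreFrom ℓ h v = concatMap (λ σ → slotsOf (fromMaybe v (follow (answer h) v σ))) (allPortSeqs ℓ)

  exploreRound : ℕ → Vec Bool (s * m) → History n d → List (Query n d)
  exploreRound ℓ ρ h = concatMap (exploreFrom ℓ h) (samples s ρ)

  opaque
    noShortCycleSeen : Vec Bool (s * m) → History n d → Bool
    noShortCycleSeen ρ h = not (does (shortCycleIn? (seenAdj? h) t))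

  explorer : Tester n d
  explorer = record { rbits = s * m ; round = exploreRound ; decide = noShortCycleSeen }

  length-samples : ∀ r ρ → length (samples r ρ) ≡ r
  length-samples zero    ρ = refl
  length-samples (suc r) ρ = cong suc (length-samples r (drop m ρ))

  length-exploreRound : ∀ ℓ ρ h → length (exploreRound ℓ ρ h) ≡ s * d ^ suc ℓ
  length-exploreRound ℓ ρ h = begin
    length (exploreRound ℓ ρ h)
      ≡⟨ length-concatMap (exploreFrom ℓ h) (samples s ρ) ⟩
    listSum (samples s ρ) (length ∘ exploreFrom ℓ h)
      ≡⟨ listSum-cong (samples s ρ) length-exploreFrom ⟩
    listSum (samples s ρ) (λ _ → d ^ suc ℓ)
      ≡⟨ listSum-const (samples s ρ) (d ^ suc ℓ) ⟩
    length (samples s ρ) * d ^ suc ℓ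
      ≡⟨ cong (_* d ^ suc ℓ) (length-samples s ρ) ⟩
    s * d ^ suc ℓ ∎
    where
    open ≡-Reasoning
    length-exploreFrom : ∀ v → length (exploreFrom ℓ h v) ≡ d ^ suc ℓ
    length-exploreFrom v = begin
      length (exploreFrom ℓ h v)
        ≡⟨ length-concatMap _ (allPortSeqs ℓ) ⟩
      listSum (allPortSeqs ℓ) (λ σ → length (slotsOf (fromMaybe v (follow (answer h) v σ))))
        ≡⟨ listSum-cong (allPortSeqs ℓ) (λ σ → trans (length-map _ (allFin d)) (length-tabulate _)) ⟩
      listSum (allPortSeqs ℓ) (λ _ → d)
        ≡⟨ listSum-const (allPortSeqs ℓ) d ⟩
      length (allPortSeqs {d} ℓ) * d
        ≡⟨ cong (_* d) (length-allPortSeqs d ℓ) ⟩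
      d ^ ℓ * d
        ≡⟨ *-comm (d ^ ℓ) d ⟩
      d ^ suc ℓ ∎

  length-runRounds : ∀ g ρ ℓ → ℓ ≤ suc k → length (runRounds explorer g ρ ℓ) ≤ ℓ * (s * d ^ (k + 1))
  length-runRounds g ρ zero    _         = z≤n
  length-runRounds g ρ (suc ℓ) (s≤s ℓ≤k) = begin
    length (h ++ map _ (exploreRound ℓ ρ h))        ≡⟨ length-++ h ⟩
    length h + length (map _ (exploreRound ℓ ρ h))  ≡⟨ cong (length h +_) (length-map _ (exploreRound ℓ ρ h)) ⟩
    length h + length (exploreRound ℓ ρ h)          ≡⟨ cong (length h +_) (length-exploreRound ℓ ρ h) ⟩
    length h + s * d ^ suc ℓ                        ≤⟨ +-mono-≤ (length-runRounds g ρ ℓ (m≤n⇒m≤1+n ℓ≤k))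
                                                                (*-monoʳ-≤ s (^-monoʳ-≤′ d (s≤s z≤n) 1+ℓ≤k+1)) ⟩
    ℓ * (s * d ^ (k + 1)) + s * d ^ (k + 1)         ≡⟨ +-comm (ℓ * (s * d ^ (k + 1))) _ ⟩
    suc ℓ * (s * d ^ (k + 1))                       ∎
    where
    open ≤-Reasoning
    h : History n d
    h = runRounds explorer g ρ ℓ
    1+ℓ≤k+1 : suc ℓ ≤ k + 1
    1+ℓ≤k+1 = subst (suc ℓ ≤_) (+-comm 1 k) (s≤s ℓ≤k)

  module _ (g : Rep n d) where

    run : Vec Bool (s * m) → ℕ → History n d
    run = runRounds explorer g

    explored : ∀ {ρ v} → v ∈ samples s ρ → ∀ ℓ → Explored g (run ρ ℓ) v ℓ
    explored v∈ zero () _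
    explored {ρ} {v} v∈ (suc ℓ) {y = y} ℓ′<1+ℓ (σ , σ↝y) i with m<1+n⇒m<n∨m≡n ℓ′<1+ℓ
    ... | inj₁ ℓ′<ℓ = ∈-++⁺ˡ (explored v∈ ℓ ℓ′<ℓ (σ , σ↝y) i)
    ... | inj₂ refl = ∈-++⁺ʳ (run ρ ℓ) (∈-map⁺ _ (∈-concatMap (∈-concatMap queried (∈-allPortSeqs σ)) v∈))
      where
      queried : (y , i) ∈ slotsOf (fromMaybe v (follow (answer (run ρ ℓ)) v σ))
      queried rewrite follow-answer g (runRounds-truthful g explorer ρ ℓ) (explored v∈ ℓ) σ | σ↝y =
        ∈-map⁺ _ (∈-allFin i)

    module _ (valid : Valid g) where
      open Valid valid using (symmetric)

      adj-sym : ∀ {x y} → Adj g x y → Adj g y x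
      adj-sym (i , gxi≡y) = symmetric _ _ i gxi≡y

      seen-sound : ∀ {ρ ℓ x y} → SeenAdj (run ρ ℓ) x y → Adj g x y
      seen-sound {ρ} {ℓ} (inj₁ xy) = answer-sound g (runRounds-truthful g explorer ρ ℓ) xy
      seen-sound {ρ} {ℓ} (inj₂ yx) = adj-sym (answer-sound g (runRounds-truthful g explorer ρ ℓ) yx)

      near-edge-answered : ∀ {ρ v x y} → v ∈ samples s ρ → Near g k v x → Adj g x y →
        Adj (answer (run ρ (suc k))) x y
      near-edge-answered {ρ} v∈ (ℓ , ℓ≤k , reach) (i , gxi≡y) =
        i , trans (answer-complete g (runRounds-truthful g explorer ρ (suc k))
                                     (explored v∈ (suc k) (s≤s ℓ≤k) reach i)) gxi≡y

      edge-seen : ∀ {ρ v x y} → v ∈ samples s ρ → Adj g x y → Near g k v x ⊎ Near g k v y →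
        SeenAdj (run ρ (suc k)) x y
      edge-seen v∈ xy (inj₁ near) = inj₁ (near-edge-answered v∈ near xy)
      edge-seen v∈ xy (inj₂ near) = inj₂ (near-edge-answered v∈ near (adj-sym xy))

      shortCycle-seen : t ≤ 2 * k + 2 → ∀ {ρ v} → v ∈ samples s ρ → ShortCycleThrough (Adj g) t v →
        ShortCycleIn (SeenAdj (run ρ (suc k))) t
      shortCycle-seen t≤2k+2 v∈ (m₀ , 3+m₀≤t , (f , inj , steps , close) , refl) =
        m₀ , 3+m₀≤t , f , inj ,
        (λ i → edge-seen v∈ (steps i) (closedWalk-edge-near adj-sym f steps close length≤ i)) ,
        edge-seen v∈ close (inj₂ (0 , z≤n , [] , refl))
        where
        length≤ : 2 + m₀ ≤ k + suc k
        length≤ = ≤-pred (≤-trans (≤-trans 3+m₀≤t t≤2k+2) (≤-reflexive (2k+2≡ k)))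
          where
          2k+2≡ : ∀ k → 2 * k + 2 ≡ suc (k + suc k)
          2k+2≡ = solve-∀

      opaque
        unfolding noShortCycleSeen

        accepts-cycleFree : CycleFree t g → ∀ ρ → noShortCycleSeen ρ (run ρ (suc k)) ≡ true
        accepts-cycleFree cycleFree ρ = cong not (dec-false (shortCycleIn? (seenAdj? (run ρ (suc k))) t)
          λ (m₀ , 3+m₀≤t , c) → cycleFree m₀ 3+m₀≤t (cycle-mono {S = Adj g} (seen-sound {ρ} {suc k}) c))

        rejects-sampledShortCycle : t ≤ 2 * k + 2 → ∀ {ρ v} → v ∈ samples s ρ → ShortCycleThrough (Adj g) t v →
          noShortCycleSeen ρ (run ρ (suc k)) ≡ false
        rejects-sampledShortCycle t≤2k+2 {ρ} v∈ c =
          cong not (dec-true (shortCycleIn? (seenAdj? (run ρ (suc k))) t) (shortCycle-seen t≤2k+2 v∈ c))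

module ExplorerAnalysis {n : ℕ} .{{_ : NonZero n}} (d k t a b : ℕ) .{{_ : NonZero a}}
                        (a≤b : a ≤ b) (t≤2k+2 : t ≤ 2 * k + 2) where

  u : ℕ
  u = 8 * b / a + 1

  s : ℕ
  s = u + u

  open Explorer {n} d k t n s
  open Repair {n} {d} t

  8b≤ua : 8 * b ≤ u * a
  8b≤ua = begin
    8 * b                           ≡⟨ m≡m%n+[m/n]*n (8 * b) a ⟩
    8 * b % a + 8 * b / a * a       ≤⟨ +-monoˡ-≤ (8 * b / a * a) (<⇒≤ (m%n<n (8 * b) a)) ⟩
    a + 8 * b / a * a               ≡⟨ +-comm a _ ⟩
    8 * b / a * a + a               ≡⟨ cong (8 * b / a * a +_) (*-identityˡ a) ⟨
    8 * b / a * a + 1 * a           ≡⟨ *-distribʳ-+ a (8 * b / a) 1 ⟨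
    u * a                           ∎
    where open ≤-Reasoning

  ua≤9b : u * a ≤ 9 * b
  ua≤9b = begin
    u * a                           ≡⟨ *-distribʳ-+ a (8 * b / a) 1 ⟩
    8 * b / a * a + 1 * a           ≤⟨ +-mono-≤ (m/n*n≤m (8 * b) a) (≤-trans (≤-reflexive (*-identityˡ a)) a≤b) ⟩
    8 * b + b                       ≡⟨ +-comm (8 * b) b ⟩
    9 * b                           ∎
    where open ≤-Reasoning

  queries : ℕ
  queries = suc k * (s * d ^ (k + 1))

  queries-bound : queries * a ≤ 18 * suc k * d ^ (k + 1) * b
  queries-bound = begin
    suc k * ((u + u) * d ^ (k + 1)) * a   ≡⟨ regroup (suc k) u (d ^ (k + 1)) a ⟩
    2 * suc k * d ^ (k + 1) * (u * a)     ≤⟨ *-monoʳ-≤ (2 * suc k * d ^ (k + 1)) ua≤9b ⟩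
    2 * suc k * d ^ (k + 1) * (9 * b)     ≡⟨ regroup′ (suc k) (d ^ (k + 1)) b ⟩
    18 * suc k * d ^ (k + 1) * b          ∎
    where
    open ≤-Reasoning
    regroup : ∀ K u D a → K * ((u + u) * D) * a ≡ 2 * K * D * (u * a)
    regroup = solve-∀
    regroup′ : ∀ K D b → 2 * K * D * (9 * b) ≡ 18 * K * D * b
    regroup′ = solve-∀

  outcomes : Rep n d → Bool → ℕ
  outcomes g out = outCount explorer k g out

  outcomes≡listSum : ∀ g out → outcomes g out
    ≡ listSum (allVecs (s * n)) (λ ρ → indicator (noShortCycleSeen ρ (run g ρ (suc k)) Bool.≟ out))
  outcomes≡listSum g out = length-filter≡listSum (λ ρ → noShortCycleSeen ρ (run g ρ (suc k)) Bool.≟ out) (allVecs (s * n))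

  accepts : ∀ g → Valid g → CycleFree t g → 2 * 2 ^ (s * n) ≤ 3 * outcomes g true
  accepts g valid free = begin
    2 * 2 ^ (s * n)                                    ≤⟨ *-monoˡ-≤ (2 ^ (s * n)) (n≤1+n 2) ⟩
    3 * 2 ^ (s * n)                                    ≡⟨ cong (3 *_) (*-identityʳ (2 ^ (s * n))) ⟨
    3 * (2 ^ (s * n) * 1)                              ≡⟨ cong (3 *_) (listSum-allVecs-const (s * n) 1) ⟨
    3 * listSum (allVecs (s * n)) (λ _ → 1)            ≡⟨ cong (3 *_) (listSum-cong (allVecs (s * n)) allAccept) ⟨
    3 * listSum (allVecs (s * n)) (λ ρ → indicator (noShortCycleSeen ρ (run g ρ (suc k)) Bool.≟ true))
                                                       ≡⟨ cong (3 *_) (outcomes≡listSum g true) ⟨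
    3 * outcomes g true                                ∎
    where
    open ≤-Reasoning
    allAccept : ∀ ρ → indicator (noShortCycleSeen ρ (run g ρ (suc k)) Bool.≟ true) ≡ 1
    allAccept ρ = indicator-yes (noShortCycleSeen ρ (run g ρ (suc k)) Bool.≟ true) (accepts-cycleFree g valid free ρ)

  module _ (g : Rep n d) (valid : Valid g) (far : FarFromCycleFree t a b g) where

    badSample goodSample : Vec Bool n → ℕ
    badSample  x = indicator (bad? g (sampleVertex x))
    goodSample x = indicator (¬? (bad? g (sampleVertex x)))

    G X : ℕ
    G = listSum (allVecs n) goodSample
    X = listSum (allVecs n) badSample

    G+X≡2ⁿ : G + X ≡ 2 ^ n
    G+X≡2ⁿ = begin
      G + X                                                    ≡⟨ listSum-+ (allVecs n) goodSample badSample ⟨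
      listSum (allVecs n) (λ x → goodSample x + badSample x)
                                                               ≡⟨ listSum-cong (allVecs n) (complementary ∘ bad? g ∘ sampleVertex) ⟩
      listSum (allVecs n) (λ _ → 1)                            ≡⟨ listSum-allVecs-const n 1 ⟩
      2 ^ n * 1                                                ≡⟨ *-identityʳ (2 ^ n) ⟩
      2 ^ n                                                    ∎
      where
      open ≡-Reasoning
      complementary : ∀ {P : Set} (P? : Dec P) → indicator (¬? P?) + indicator P? ≡ 1
      complementary (yes _) = refl
      complementary (no  _) = refl

    2ⁿ≤uX : 2 ^ n ≤ u * X
    2ⁿ≤uX = *-cancelˡ-≤ n (*-cancelˡ-≤ a (begin
      a * (n * 2 ^ n)                   ≡⟨ *-assoc a n (2 ^ n) ⟨
      a * n * 2 ^ n                     ≤⟨ *-monoˡ-≤ (2 ^ n) (<⇒≤ (far⇒manyBad {a} {b} valid far)) ⟩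
      b * (4 * badCount g) * 2 ^ n      ≡⟨ regroup b (badCount g) (2 ^ n) ⟩
      4 * b * (badCount g * 2 ^ n)      ≤⟨ *-monoʳ-≤ (4 * b) (mod-sampling (bad? g) n (n≤2^n n)) ⟩
      4 * b * (2 * n * X)               ≡⟨ regroup′ b n X ⟩
      n * (8 * b * X)                   ≤⟨ *-monoʳ-≤ n (*-monoˡ-≤ X 8b≤ua) ⟩
      n * (u * a * X)                   ≡⟨ regroup″ n u a X ⟩
      a * (n * (u * X))                 ∎))
      where
      open ≤-Reasoning
      regroup : ∀ b c N → b * (4 * c) * N ≡ 4 * b * (c * N)
      regroup = solve-∀
      regroup′ : ∀ b n X → 4 * b * (2 * n * X) ≡ n * (8 * b * X)
      regroup′ = solve-∀
      regroup″ : ∀ n u a X → n * (u * a * X) ≡ a * (n * (u * X))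
      regroup″ = solve-∀

    4Gˢ≤2ˢⁿ : 4 * G ^ s ≤ 2 ^ (s * n)
    4Gˢ≤2ˢⁿ = begin
      4 * G ^ (u + u)      ≤⟨ ^-quarters G (G + X) u (^-halves G X u (≤-trans (≤-reflexive G+X≡2ⁿ) 2ⁿ≤uX)
                                                       (subst (0 <_) (sym G+X≡2ⁿ) (m^n>0 2 n))) ⟩
      (G + X) ^ (u + u)    ≡⟨ cong (_^ s) G+X≡2ⁿ ⟩
      (2 ^ n) ^ s          ≡⟨ ^-*-assoc 2 n s ⟩
      2 ^ (n * s)          ≡⟨ cong (2 ^_) (*-comm n s) ⟩
      2 ^ (s * n)          ∎
      where open ≤-Reasoning

    allGood⇒blockProduct≡1 : ∀ r ρ → (∀ {v} → v ∈ samples r ρ → ¬ Bad g v) → blockProduct goodSample r ρ ≡ 1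
    allGood⇒blockProduct≡1 zero    ρ none = refl
    allGood⇒blockProduct≡1 (suc r) ρ none =
      cong₂ _*_ (indicator-yes (¬? (bad? g _)) (none (here refl))) (allGood⇒blockProduct≡1 r (drop n ρ) (none ∘ there))

    rejected-or-allGood : ∀ ρ →
      1 ≤ indicator (noShortCycleSeen ρ (run g ρ (suc k)) Bool.≟ false) + blockProduct goodSample s ρ
    rejected-or-allGood ρ with noShortCycleSeen ρ (run g ρ (suc k)) in decision
    ... | false = s≤s z≤n
    ... | true  = ≤-reflexive (sym (allGood⇒blockProduct≡1 s ρ λ v∈ bad →
                    contradiction (trans (sym decision) (rejects-sampledShortCycle g valid t≤2k+2 v∈ bad)) λ ()))

    2ˢⁿ≤rejections+Gˢ : 2 ^ (s * n) ≤ outcomes g false + G ^ s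
    2ˢⁿ≤rejections+Gˢ = begin
      2 ^ (s * n)                                    ≡⟨ *-identityʳ (2 ^ (s * n)) ⟨
      2 ^ (s * n) * 1                                ≡⟨ listSum-allVecs-const (s * n) 1 ⟨
      listSum (allVecs (s * n)) (λ _ → 1)            ≤⟨ listSum-mono (allVecs (s * n)) rejected-or-allGood ⟩
      listSum (allVecs (s * n)) (λ ρ → indicator (noShortCycleSeen ρ (run g ρ (suc k)) Bool.≟ false)
                                       + blockProduct goodSample s ρ)
                                                     ≡⟨ listSum-+ (allVecs (s * n)) _ (blockProduct goodSample s) ⟩
      listSum (allVecs (s * n)) (λ ρ → indicator (noShortCycleSeen ρ (run g ρ (suc k)) Bool.≟ false))
        + listSum (allVecs (s * n)) (blockProduct goodSample s)
                                   ≡⟨ cong₂ _+_ (sym (outcomes≡listSum g false)) (listSum-blockProduct goodSample s) ⟩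
      outcomes g false + G ^ s                       ∎
      where open ≤-Reasoning

    rejects : 2 * 2 ^ (s * n) ≤ 3 * outcomes g false
    rejects = two-thirds {O = outcomes g false} 2ˢⁿ≤rejections+Gˢ 4Gˢ≤2ˢⁿ

  isTester : IsRoundAdaptiveTester t k queries a b explorer
  isTester = record
    { queryBound = λ g ρ → length-runRounds g ρ (suc k) ≤-refl
    ; accepts    = accepts
    ; rejects    = rejects
    }

cycleFreenessTester : ∀ {n} .{{_ : NonZero n}} d k t a b .{{_ : NonZero a}} → a ≤ b → t ≤ 2 * k + 2 →
  ∃ λ q → q * a ≤ 18 * suc k * d ^ (k + 1) * b × ∃ λ (A : Tester n d) → IsRoundAdaptiveTester t k q a b A
cycleFreenessTester {n} d k t a b a≤b t≤2k+2 = queries , queries-bound , _ , isTester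
  where open ExplorerAnalysis {n} d k t a b a≤b t≤2k+2

mainTheorem6 : ∀ (k : ℕ) → ∃ λ (C : ℕ) →
    ∀ (n d a b : ℕ) → d < n → 0 < a → a ≤ b →
      (∃ λ (q : ℕ) → q * a ≤ C * (d ^ (k + 1)) * b ×
         ∃ λ (A : Tester n d) → IsRoundAdaptiveTester (2 * k + 1) k q a b A)
      × (∃ λ (q : ℕ) → q * a ≤ C * (d ^ (k + 1)) * b ×
         ∃ λ (A : Tester n d) → IsRoundAdaptiveTester (2 * k + 2) k q a b A)
mainTheorem6 k = 18 * suc k , λ where
  (suc n) d (suc a) b _ _ a≤b →
    cycleFreenessTester d k (2 * k + 1) (suc a) b a≤b (+-monoʳ-≤ (2 * k) (n≤1+n 1)) ,
    cycleFreenessTester d k (2 * k + 2) (suc a) b a≤b ≤-refl
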